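{- Let $S$ be a nonempty finite set and $\mathcal{F}$ a reduced union-closed family on $S$. For $x\in S$ let $\delta_x=|\{A\in\mathcal{F}: x\in A\}|-|\{A\in\mathcal{F}: x\notin A\}|$. If $$\sum_{(A,B)\in\mathcal{F}^2}|A\cap B|+\sum_{x\in S}\delta_x^2\ \ge\ \sum_{(A,B)\in\mathcal{F}^2}|A^C\cap B^C|,$$ then $$\sum_{(A,B)\in\mathcal{F}^2}|A\cap B|\ \ge\ \sum_{(A,B)\in\mathcal{F}^2}|A\setminus B|.$$
   Context: A reduced union-closed family on $S$ is a family $\mathcal{F}$ of subsets of $S$ such that $\varnothing,S\in\mathcal{F}$, for every $x\in S$ there are $A,B\in\mathcal{F}$ with $A\setminus B=\{x\}$, and $A\cup B\in\mathcal{F}$ for all $A,B\in\mathcal{F}$. Complements $A^C$ are taken in $S$; $\mathcal{F}^2$ is the set of ordered pairs of members of $\mathcal{F}$. -}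

module Defs where

open import Data.Nat using (ℕ)
open import Data.Fin using (Fin)
open import Data.Fin.Subset using (Subset; ⊥; ⊤; _∪_; _∩_; _─_; ∁; ∣_∣; ⁅_⁆)
open import Data.Fin.Subset.Properties using (_∈?_)
open import Data.List using (List; map; filter; length; allFin; concatMap; foldr)
open import Data.Nat.ListAction using (sum)
open import Data.List.Membership.Propositional using (_∈_)
open import Data.List.Relation.Unary.Unique.Propositional using (Unique)
open import Data.Product using (_×_; ∃₂)
open import Data.Integer using (ℤ; +_; _-_) renaming (_+_ to _+ℤ_; _*_ to _*ℤ_)
open import Relation.Binary.PropositionalEquality using (_≡_)

-- S = Fin n.  A family of subsets of S is represented as a list of subsets;
-- the reducedness record demands the list be duplicate-free, so sums over
-- the list are sums over the family (as a set).
Family : ℕ → Set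
Family n = List (Subset n)

record ReducedUnionClosed {n : ℕ} (F : Family n) : Set where
  field
    distinct     : Unique F
    has-empty    : ⊥ ∈ F
    has-full     : ⊤ ∈ F
    separating   : ∀ (x : Fin n) → ∃₂ λ A B → A ∈ F × B ∈ F × (A ─ B ≡ ⁅ x ⁆)
    union-closed : ∀ {A B} → A ∈ F → B ∈ F → (A ∪ B) ∈ F

sumPairs : ∀ {n} → Family n → (Subset n → Subset n → ℕ) → ℕ
sumPairs F f = sum (concatMap (λ A → map (λ B → f A B) F) F)

count∈ : ∀ {n} → Family n → Fin n → ℕ
count∈ F x = length (filter (x ∈?_) F)

count∉ : ∀ {n} → Family n → Fin n → ℕ
count∉ F x = length (filter (λ A → x ∈? ∁ A) F)

δ : ∀ {n} → Family n → Fin n → ℤ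
δ F x = + count∈ F x - + count∉ F x

sumδ² : ∀ {n} → Family n → ℤ
sumδ² {n} F = foldr _+ℤ_ (+ 0) (map (λ x → δ F x *ℤ δ F x) (allFin n))

module Submission where

-- Proof idea.  For a point x of S write  a x = |{A ∈ F : x ∈ A}|  and
-- b x = |{A ∈ F : x ∉ A}|.  Counting the pairs (A , B) point by point,
--
--   Σ_{F²} |A ∩ B| = Σ_x a x ²,   Σ_{F²} |Aᶜ ∩ Bᶜ| = Σ_x b x ²,
--   Σ_{F²} |A ─ B| = Σ_x a x · b x,
--
-- and δ x = a x − b x, so  Σ_x δ x ² + 2 Σ_x a x b x = Σ_x a x ² + Σ_x b x ².
-- Substituting these into the hypothesis  Σ b² ≤ Σ a² + Σ δ²  gives
-- 2 Σ a b ≤ 2 Σ a², i.e. the claim.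

open import Defs
open import Data.Nat using (ℕ; suc; _≤_)
open import Data.Fin.Subset using (_∩_; _─_; ∁; ∣_∣)
open import Data.Integer using (+_; _+_) renaming (_≤_ to _≤ℤ_)

open import Data.Nat using (zero; _*_) renaming (_+_ to _+ℕ_)
import Data.Nat.Properties as ℕP
open import Data.Fin using (Fin; zero; suc)
open import Data.Fin.Subset using (Subset)
open import Data.Fin.Subset.Properties using (_∈?_)
open import Data.Bool using (Bool; true; false)
open import Data.Vec using ([]; _∷_; lookup)
open import Data.List using (List; []; _∷_; map; filter; length; allFin; tabulate; concatMap; foldr)
open import Data.List.Properties using (map-cong; map-tabulate)
open import Data.Nat.ListAction using (sum)
open import Data.Nat.ListAction.Properties using (sum-++)
open import Data.Integer as ℤ using (ℤ)
import Data.Integer.Properties as ℤP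
open import Data.Integer.Tactic.RingSolver using (solve-∀)
import Data.Nat.Tactic.RingSolver as ℕSolver
open import Function using (_∘_)
open import Relation.Nullary using (does; yes; no)
open import Relation.Binary.PropositionalEquality
open import Algebra.Properties.CommutativeSemigroup ℕP.+-commutativeSemigroup
  using () renaming (interchange to +-interchange)
open import Algebra.Properties.CommutativeSemigroup ℤP.+-commutativeSemigroup
  using () renaming (interchange to +ℤ-interchange)

sumOver : ∀ {A : Set} → List A → (A → ℕ) → ℕ
sumOver L f = sum (map f L)

sumOver-cong : ∀ {A : Set} (L : List A) {f g : A → ℕ} →
  (∀ a → f a ≡ g a) → sumOver L f ≡ sumOver L g
sumOver-cong L f≗g = cong sum (map-cong f≗g L)

sumOver-+ : ∀ {A : Set} (L : List A) (f g : A → ℕ) →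
  sumOver L (λ a → f a +ℕ g a) ≡ sumOver L f +ℕ sumOver L g
sumOver-+ []      f g = refl
sumOver-+ (x ∷ L) f g = begin
  (f x +ℕ g x) +ℕ sumOver L (λ a → f a +ℕ g a)   ≡⟨ cong ((f x +ℕ g x) +ℕ_) (sumOver-+ L f g) ⟩
  (f x +ℕ g x) +ℕ (sumOver L f +ℕ sumOver L g)   ≡⟨ +-interchange (f x) (g x) _ _ ⟩
  (f x +ℕ sumOver L f) +ℕ (g x +ℕ sumOver L g)   ∎
  where open ≡-Reasoning

sumOver-*ʳ : ∀ {A : Set} (L : List A) (c : ℕ) (f : A → ℕ) →
  sumOver L (λ a → f a * c) ≡ sumOver L f * c
sumOver-*ʳ []      c f = refl
sumOver-*ʳ (x ∷ L) c f =
  trans (cong (f x * c +ℕ_) (sumOver-*ʳ L c f)) (sym (ℕP.*-distribʳ-+ c (f x) (sumOver L f)))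

sumOver-*ˡ : ∀ {A : Set} (L : List A) (c : ℕ) (f : A → ℕ) →
  sumOver L (λ a → c * f a) ≡ c * sumOver L f
sumOver-*ˡ L c f = begin
  sumOver L (λ a → c * f a)  ≡⟨ sumOver-cong L (λ a → ℕP.*-comm c (f a)) ⟩
  sumOver L (λ a → f a * c)  ≡⟨ sumOver-*ʳ L c f ⟩
  sumOver L f * c            ≡⟨ ℕP.*-comm (sumOver L f) c ⟩
  c * sumOver L f            ∎
  where open ≡-Reasoning

sumOver-zero : ∀ {A : Set} (L : List A) → sumOver L (λ _ → 0) ≡ 0
sumOver-zero []      = refl
sumOver-zero (_ ∷ L) = sumOver-zero L

sumOver-swap : ∀ {A B : Set} (xs : List A) (ys : List B) (h : A → B → ℕ) →
  sumOver xs (λ a → sumOver ys (h a)) ≡ sumOver ys (λ b → sumOver xs (λ a → h a b))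
sumOver-swap []       ys h = sym (sumOver-zero ys)
sumOver-swap (x ∷ xs) ys h =
  trans (cong (sumOver ys (h x) +ℕ_) (sumOver-swap xs ys h))
        (sym (sumOver-+ ys (h x) (λ b → sumOver xs (λ a → h a b))))

sumOver-product : ∀ {A : Set} (L : List A) (u v : A → ℕ) →
  sumOver L (λ a → sumOver L (λ b → u a * v b)) ≡ sumOver L u * sumOver L v
sumOver-product L u v =
  trans (sumOver-cong L (λ a → sumOver-*ˡ L (u a) v)) (sumOver-*ʳ L (sumOver L v) u)

sumPairs-nested : ∀ {n} (F : Family n) (f : Subset n → Subset n → ℕ) →
  sumPairs F f ≡ sumOver F (λ A → sumOver F (f A))
sumPairs-nested F f = go F
  where
  go : ∀ xs → sum (concatMap (λ A → map (f A) F) xs) ≡ sumOver xs (λ A → sumOver F (f A))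
  go []       = refl
  go (A ∷ xs) = trans (sum-++ (map (f A) F) _) (cong (sumOver F (f A) +ℕ_) (go xs))

χ : Bool → ℕ
χ true  = 1
χ false = 0

indicator : ∀ {n} → Subset n → Fin n → ℕ
indicator s x = χ (lookup s x)

card-as-sum : ∀ {n} (s : Subset n) → ∣ s ∣ ≡ sumOver (allFin n) (indicator s)
card-as-sum []              = refl
card-as-sum {suc n} (b ∷ s) = trans (head b) (cong (χ b +ℕ_) (trans (card-as-sum s) shift))
  where
  head : ∀ b → ∣ b ∷ s ∣ ≡ χ b +ℕ ∣ s ∣
  head true  = refl
  head false = refl
  shift : sumOver (allFin n) (indicator s) ≡ sumOver (tabulate suc) (indicator (b ∷ s))
  shift = cong sum (trans (map-tabulate (λ i → i) (indicator s))
                          (sym (map-tabulate suc (indicator (b ∷ s)))))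

indicator-∩ : ∀ {n} (A B : Subset n) x → indicator (A ∩ B) x ≡ indicator A x * indicator B x
indicator-∩ (true  ∷ A) (true  ∷ B) zero    = refl
indicator-∩ (true  ∷ A) (false ∷ B) zero    = refl
indicator-∩ (false ∷ A) (b     ∷ B) zero    = refl
indicator-∩ (a     ∷ A) (b     ∷ B) (suc x) = indicator-∩ A B x

indicator-─ : ∀ {n} (A B : Subset n) x → indicator (A ─ B) x ≡ indicator A x * indicator (∁ B) x
indicator-─ (true  ∷ A) (true  ∷ B) zero    = refl
indicator-─ (true  ∷ A) (false ∷ B) zero    = refl
indicator-─ (false ∷ A) (true  ∷ B) zero    = refl
indicator-─ (false ∷ A) (false ∷ B) zero    = refl
indicator-─ (a     ∷ A) (b     ∷ B) (suc x) = indicator-─ A B x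

does-∈? : ∀ {n} (x : Fin n) (A : Subset n) → χ (does (x ∈? A)) ≡ indicator A x
does-∈? zero    (true  ∷ A) = refl
does-∈? zero    (false ∷ A) = refl
does-∈? (suc x) (a     ∷ A) = does-∈? x A

-- |{A ∈ F : x ∈ g A}| = Σ_{A ∈ F} [x ∈ g A]; covers count∈ (g = id) and count∉ (g = ∁).
count-as-sum : ∀ {n} (F : Family n) (g : Subset n → Subset n) x →
  length (filter (λ A → x ∈? g A) F) ≡ sumOver F (λ A → indicator (g A) x)
count-as-sum []      g x = refl
count-as-sum (A ∷ F) g x with x ∈? g A | does-∈? x (g A)
... | yes _ | χ≡ = trans (cong suc (count-as-sum F g x)) (cong (_+ℕ _) χ≡)
... | no  _ | χ≡ = trans (count-as-sum F g x) (cong (_+ℕ _) χ≡)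

sumPairs-factor : ∀ {n} (F : Family n) (op : Subset n → Subset n → Subset n)
  (u v : Subset n → Fin n → ℕ) →
  (∀ A B x → indicator (op A B) x ≡ u A x * v B x) →
  sumPairs F (λ A B → ∣ op A B ∣)
    ≡ sumOver (allFin n) (λ x → sumOver F (λ A → u A x) * sumOver F (λ B → v B x))
sumPairs-factor {n} F op u v factor = begin
  sumPairs F (λ A B → ∣ op A B ∣)
    ≡⟨ sumPairs-nested F _ ⟩
  sumOver F (λ A → sumOver F (λ B → ∣ op A B ∣))
    ≡⟨ sumOver-cong F (λ A → sumOver-cong F (λ B → card-as-sum (op A B))) ⟩
  sumOver F (λ A → sumOver F (λ B → sumOver S (indicator (op A B))))
    ≡⟨ sumOver-cong F (λ A → sumOver-swap F S (λ B → indicator (op A B))) ⟩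
  sumOver F (λ A → sumOver S (λ x → sumOver F (λ B → indicator (op A B) x)))
    ≡⟨ sumOver-swap F S _ ⟩
  sumOver S (λ x → sumOver F (λ A → sumOver F (λ B → indicator (op A B) x)))
    ≡⟨ sumOver-cong S (λ x → sumOver-cong F (λ A → sumOver-cong F (λ B → factor A B x))) ⟩
  sumOver S (λ x → sumOver F (λ A → sumOver F (λ B → u A x * v B x)))
    ≡⟨ sumOver-cong S (λ x → sumOver-product F (λ A → u A x) (λ B → v B x)) ⟩
  sumOver S (λ x → sumOver F (λ A → u A x) * sumOver F (λ B → v B x)) ∎
  where
  open ≡-Reasoning
  S = allFin n

-- Σ_{a ∈ L} g a in ℤ (the shape used by sumδ²).
sumOverℤ : ∀ {A : Set} → List A → (A → ℤ) → ℤ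
sumOverℤ L g = foldr ℤ._+_ (+ 0) (map g L)

sumOverℤ-+ : ∀ {A : Set} (L : List A) (g h : A → ℤ) →
  sumOverℤ L g + sumOverℤ L h ≡ sumOverℤ L (λ a → g a + h a)
sumOverℤ-+ []      g h = refl
sumOverℤ-+ (x ∷ L) g h =
  trans (+ℤ-interchange (g x) _ (h x) _) (cong (λ t → (g x + h x) + t) (sumOverℤ-+ L g h))

sumOverℤ-pos : ∀ {A : Set} (L : List A) (f : A → ℕ) →
  sumOverℤ L (λ a → + f a) ≡ + sumOver L f
sumOverℤ-pos []      f = refl
sumOverℤ-pos (x ∷ L) f =
  trans (cong (λ t → + f x + t) (sumOverℤ-pos L f)) (sym (ℤP.pos-+ (f x) (sumOver L f)))

square-identity : ∀ (a b : ℕ) →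
  (+ a ℤ.- + b) ℤ.* (+ a ℤ.- + b) + + (2 * (a * b)) ≡ + (a * a +ℕ b * b)
square-identity a b = begin
  (+ a ℤ.- + b) ℤ.* (+ a ℤ.- + b) + + (2 * (a * b))
    ≡⟨ cong (λ t → (+ a ℤ.- + b) ℤ.* (+ a ℤ.- + b) + t)
            (trans (ℤP.pos-* 2 (a * b)) (cong (+ 2 ℤ.*_) (ℤP.pos-* a b))) ⟩
  (+ a ℤ.- + b) ℤ.* (+ a ℤ.- + b) + + 2 ℤ.* (+ a ℤ.* + b)
    ≡⟨ expand (+ a) (+ b) ⟩
  + a ℤ.* + a + + b ℤ.* + b
    ≡⟨ sym (trans (ℤP.pos-+ (a * a) (b * b)) (cong₂ ℤ._+_ (ℤP.pos-* a a) (ℤP.pos-* b b))) ⟩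
  + (a * a +ℕ b * b) ∎
  where
  open ≡-Reasoning
  expand : ∀ α β → (α ℤ.- β) ℤ.* (α ℤ.- β) + + 2 ℤ.* (α ℤ.* β) ≡ α ℤ.* α + β ℤ.* β
  expand = solve-∀

sum-of-squares : ∀ {A : Set} (L : List A) (a b : A → ℕ) →
  sumOverℤ L (λ x → (+ a x ℤ.- + b x) ℤ.* (+ a x ℤ.- + b x)) + + (2 * sumOver L (λ x → a x * b x))
    ≡ + (sumOver L (λ x → a x * a x) +ℕ sumOver L (λ x → b x * b x))
sum-of-squares L a b = begin
  D + + (2 * sumOver L (λ x → a x * b x))
    ≡⟨ cong (λ t → D + + t) (sym (sumOver-*ˡ L 2 (λ x → a x * b x))) ⟩
  D + + sumOver L (λ x → 2 * (a x * b x))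
    ≡⟨ cong (λ t → D + t) (sym (sumOverℤ-pos L (λ x → 2 * (a x * b x)))) ⟩
  D + sumOverℤ L (λ x → + (2 * (a x * b x)))
    ≡⟨ sumOverℤ-+ L _ _ ⟩
  sumOverℤ L (λ x → (+ a x ℤ.- + b x) ℤ.* (+ a x ℤ.- + b x) + + (2 * (a x * b x)))
    ≡⟨ cong (foldr ℤ._+_ (+ 0)) (map-cong (λ x → square-identity (a x) (b x)) L) ⟩
  sumOverℤ L (λ x → + (a x * a x +ℕ b x * b x))
    ≡⟨ sumOverℤ-pos L _ ⟩
  + sumOver L (λ x → a x * a x +ℕ b x * b x)
    ≡⟨ cong +_ (sumOver-+ L _ _) ⟩
  + (sumOver L (λ x → a x * a x) +ℕ sumOver L (λ x → b x * b x)) ∎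
  where
  open ≡-Reasoning
  D = sumOverℤ L (λ x → (+ a x ℤ.- + b x) ℤ.* (+ a x ℤ.- + b x))

halve-inequality : ∀ (p q r : ℕ) (d : ℤ) →
  d + + (2 * r) ≡ + (p +ℕ q) → + q ≤ℤ + p + d → r ≤ p
halve-inequality p q r d identity q≤p+d =
  ℕP.*-cancelˡ-≤ 2 (ℕP.+-cancelʳ-≤ q (2 * r) (2 * p)
    (subst₂ _≤_ (ℕP.+-comm q (2 * r)) (regroup p q) (ℤP.drop‿+≤+ shifted)))
  where
  -- Add 2r to both sides of q ≤ p + d and use the identity on the right.
  shifted : + (q +ℕ 2 * r) ≤ℤ + (p +ℕ (p +ℕ q))
  shifted = subst₂ _≤ℤ_ (sym (ℤP.pos-+ q (2 * r)))
              (trans (ℤP.+-assoc (+ p) d _)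
                     (trans (cong (λ t → + p + t) identity) (sym (ℤP.pos-+ p (p +ℕ q)))))
              (ℤP.+-monoˡ-≤ (+ (2 * r)) q≤p+d)
  regroup : ∀ p q → p +ℕ (p +ℕ q) ≡ 2 * p +ℕ q
  regroup = ℕSolver.solve-∀

proposition6 : ∀ (n : ℕ) (F : Family (suc n)) → ReducedUnionClosed F
    → + sumPairs F (λ A B → ∣ ∁ A ∩ ∁ B ∣) ≤ℤ + sumPairs F (λ A B → ∣ A ∩ B ∣) + sumδ² F
    → sumPairs F (λ A B → ∣ A ─ B ∣) ≤ sumPairs F (λ A B → ∣ A ∩ B ∣)
proposition6 n F _ hypothesis =
  subst₂ _≤_ (sym Σ[A─B]) (sym Σ[A∩B])
    (halve-inequality (Σ λ x → a x * a x) (Σ λ x → b x * b x) (Σ λ x → a x * b x) (sumδ² F)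
      δ-identity (subst₂ (λ u v → + u ≤ℤ + v + sumδ² F) Σ[Aᶜ∩Bᶜ] Σ[A∩B] hypothesis))
  where
  Σ : (Fin (suc n) → ℕ) → ℕ
  Σ = sumOver (allFin (suc n))
  a b : Fin (suc n) → ℕ
  a x = sumOver F (λ A → indicator A x)
  b x = sumOver F (λ A → indicator (∁ A) x)
  Σ[A∩B] : sumPairs F (λ A B → ∣ A ∩ B ∣) ≡ Σ λ x → a x * a x
  Σ[A∩B] = sumPairs-factor F _∩_ indicator indicator indicator-∩
  Σ[Aᶜ∩Bᶜ] : sumPairs F (λ A B → ∣ ∁ A ∩ ∁ B ∣) ≡ Σ λ x → b x * b x
  Σ[Aᶜ∩Bᶜ] = sumPairs-factor F (λ A B → ∁ A ∩ ∁ B) (indicator ∘ ∁) (indicator ∘ ∁)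
               (λ A B → indicator-∩ (∁ A) (∁ B))
  Σ[A─B] : sumPairs F (λ A B → ∣ A ─ B ∣) ≡ Σ λ x → a x * b x
  Σ[A─B] = sumPairs-factor F _─_ indicator (indicator ∘ ∁) indicator-─
  δ-identity : sumδ² F + + (2 * Σ λ x → a x * b x) ≡ + ((Σ λ x → a x * a x) +ℕ (Σ λ x → b x * b x))
  δ-identity = trans
    (cong (λ l → foldr _+_ (+ 0) l + + (2 * Σ λ x → a x * b x))
      (map-cong (λ x → cong₂ (λ p q → (+ p ℤ.- + q) ℤ.* (+ p ℤ.- + q))
                              (count-as-sum F (λ A → A) x) (count-as-sum F ∁ x)) (allFin (suc n))))
    (sum-of-squares (allFin (suc n)) a b)
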